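{- Let $a,b \in \mathbf{N}$ with $a \leq b$. Then $dor(a,b)=1$ if and only if $b=2a$. Furthermore, if $b \neq 2a$, then $N(a,b;2)$ exists and \[ N(a,b;2) \leq \begin{cases} 4a(b^3+b^2-3b-3)+2b^3+6b^2+6b & \text{if } b > 2a,\\ 4a(b^3+2b^2+2b)-4b^2 & \text{if } b < 2a. \end{cases} \]
   Context: $\mathbf{N}=\{1,2,3,\dots\}$ and $[1,n]=\{1,2,\dots,n\}$. Fix integers $1 \leq a \leq b$. A set $S$ of three natural numbers is an $(a,b)$-triple if there exist natural numbers $x,d$ with $S=\{x,ax+d,bx+2d\}$. An $r$-coloring of a set is a map from it to a set of $r$ colors. $N(a,b;r)$ is the least positive integer, if it exists, such that every $r$-coloring of $[1,N(a,b;r)]$ contains a monochromatic $(a,b)$-triple. The pair $(a,b)$ is regular if $N(a,b;r)$ exists for all positive integers $r$; if $(a,b)$ is not regular, its degree of regularity $dor(a,b)$ is the largest $r$ such that $N(a,b;r)$ exists. -}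

module Defs where

open import Data.Nat using (ℕ; zero; suc; _+_; _*_; _∸_; _^_; _≤_; _<_)
open import Data.Fin using (Fin)
open import Data.Product using (Σ; ∃; _×_; _,_)
open import Relation.Binary.PropositionalEquality using (_≡_; _≢_)
open import Relation.Nullary using (¬_)

-- S is an (a,b)-triple witnessed by x,d ∈ ℕ = {1,2,...}:
-- S = {x, a x + d, b x + 2 d}, a set of three (distinct) natural numbers.
-- A monochromatic (a,b)-triple inside [1,n] under the coloring c.
-- (A coloring of [1,n] is represented by c : ℕ → Fin r; only its values on
--  [1,n] are used, and every coloring of [1,n] extends to such a c.)
MonoTriple : (a b n r : ℕ) → (ℕ → Fin r) → Set
MonoTriple a b n r c =
  Σ ℕ λ x → Σ ℕ λ d →
    1 ≤ x × 1 ≤ d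
    × x ≢ a * x + d × x ≢ b * x + 2 * d × a * x + d ≢ b * x + 2 * d
    × b * x + 2 * d ≤ n × a * x + d ≤ n
    × c (a * x + d) ≡ c x × c (b * x + 2 * d) ≡ c x

Forces : (a b r n : ℕ) → Set
Forces a b r n = (c : ℕ → Fin r) → MonoTriple a b n r c

IsN : (a b r n : ℕ) → Set
IsN a b r n = 1 ≤ n × Forces a b r n × ((m : ℕ) → 1 ≤ m → Forces a b r m → n ≤ m)

NExists : (a b r : ℕ) → Set
NExists a b r = ∃ λ n → IsN a b r n

Regular : (a b : ℕ) → Set
Regular a b = (r : ℕ) → 1 ≤ r → NExists a b r

Dor : (a b k : ℕ) → Set
Dor a b k = ¬ Regular a b × 1 ≤ k × NExists a b k
            × ((r : ℕ) → 1 ≤ r → NExists a b r → r ≤ k)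

-- Write an (a,b)-triple as x, y, thirdTerm a b x y = b x + 2 (y - a x).  If b = 2a the
-- third term is 2y, and colouring n by the parity of ⌊log₂ n⌋ avoids every triple with any
-- number of colours, while a single colour is forced trivially; so dor(a,2a) = 1.
--
-- If b ≠ 2a, take two points p and q = p ± 2s of different colours, ordered so that
-- thirdTerm p y = thirdTerm q (y + D) with D = |b - 2a| s.  In a 2-colouring without
-- monochromatic triples, a point y of colour c p forces thirdTerm p y to have colour c q,
-- hence y + D cannot have colour c q: the colour c p propagates along y, y + D, y + 2D, ...
-- This is absurd as soon as thirdTerm p y = y + j D for some j, because then thirdTerm p y
-- itself receives colour c p.  Such a y exists in either colour class, so every 2-colouring of a
-- long enough interval has a monochromatic triple.  The pair (p, q) is taken from the triple
-- (2, 2a + 2, 2b + 4), two of whose members differ in colour; estimating the orbits gives the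
-- stated bounds, except for a = b = 1 (three-term progressions), which is checked exhaustively.

module Submission where

open import Defs
open import Data.Nat using (ℕ; zero; suc; _+_; _*_; _∸_; _^_; _≤_; _<_; z≤n; s≤s; _≟_; _≤?_; >-nonZero)
open import Data.Nat.Properties
open import Data.Nat.Logarithm using (⌊log₂_⌋; ⌊log₂[2*b]⌋≡1+⌊log₂b⌋)
open import Data.Nat.Tactic.RingSolver using (solve-∀)
open import Data.Fin using (Fin; toℕ; fromℕ<; opposite; _↑ˡ_) renaming (zero to 0F; suc to sucF)
import Data.Fin.Properties as Finₚ
open import Data.Vec using (Vec; []; _∷_; lookup; tabulate)
open import Data.Vec.Properties using (lookup∘tabulate)
open import Data.Product using (∃; ∃₂; _×_; _,_)
open import Data.Sum using (_⊎_; inj₁; inj₂; [_,_]′)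
open import Data.Empty using (⊥; ⊥-elim)
open import Function using (_∘_)
open import Function.Bundles using (_⇔_; mk⇔)
open import Relation.Binary using (tri<; tri≈; tri>)
open import Relation.Binary.PropositionalEquality
  using (_≡_; _≢_; refl; sym; trans; cong; cong₂; subst; module ≡-Reasoning)
open import Relation.Nullary using (¬_; Dec; yes; no)
open import Relation.Nullary.Decidable using (map′; _×-dec_; ¬?; toWitness; decidable-stable)
import Relation.Unary as U

thirdTerm : (a b x y : ℕ) → ℕ
thirdTerm a b x y = b * x + 2 * (y ∸ a * x)

thirdTerm-mono : ∀ a b x {y y′} → y ≤ y′ → thirdTerm a b x y ≤ thirdTerm a b x y′
thirdTerm-mono a b x y≤y′ = +-monoʳ-≤ (b * x) (*-monoʳ-≤ 2 (∸-monoˡ-≤ (a * x) y≤y′))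

thirdTerm-+ : ∀ a b x {y} w → a * x ≤ y → thirdTerm a b x (y + w) ≡ thirdTerm a b x y + 2 * w
thirdTerm-+ a b x {y} w ax≤y = begin
  b * x + 2 * (y + w ∸ a * x)   ≡⟨ cong (λ d → b * x + 2 * d) (+-∸-comm w ax≤y) ⟩
  b * x + 2 * (y ∸ a * x + w)   ≡⟨ distrib (b * x) (y ∸ a * x) w ⟩
  b * x + 2 * (y ∸ a * x) + 2 * w ∎
  where
  open ≡-Reasoning
  distrib : ∀ p d w → p + 2 * (d + w) ≡ p + 2 * d + 2 * w
  distrib = solve-∀

≤-thirdTerm : ∀ {a b} x {y} → a ≤ b → a * x ≤ y → y ≤ thirdTerm a b x y
≤-thirdTerm {a} {b} x {y} a≤b ax≤y = begin
  y                         ≡⟨ sym (m+[n∸m]≡n ax≤y) ⟩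
  a * x + (y ∸ a * x)       ≤⟨ +-mono-≤ (*-monoˡ-≤ x a≤b) (m≤m+n (y ∸ a * x) _) ⟩
  b * x + 2 * (y ∸ a * x)   ∎
  where open ≤-Reasoning

MonoTripleAt : (a b n r : ℕ) → (ℕ → Fin r) → ℕ → ℕ → Set
MonoTripleAt a b n r c x d =
  1 ≤ x × 1 ≤ d
  × x ≢ a * x + d × x ≢ b * x + 2 * d × a * x + d ≢ b * x + 2 * d
  × b * x + 2 * d ≤ n × a * x + d ≤ n
  × c (a * x + d) ≡ c x × c (b * x + 2 * d) ≡ c x

module _ {a b : ℕ} (1≤a : 1 ≤ a) where

  x≤ax+d : ∀ x d → x ≤ a * x + d
  x≤ax+d x d = ≤-trans (m≤n*m x a {{>-nonZero 1≤a}}) (m≤m+n (a * x) d)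

  monoTriple : ∀ {n r} (c : ℕ → Fin r) {x d} → a ≤ b → 1 ≤ x → 1 ≤ d → b * x + 2 * d ≤ n →
               c (a * x + d) ≡ c x → c (b * x + 2 * d) ≡ c x → MonoTriple a b n r c
  monoTriple c {x} {d} a≤b 1≤x 1≤d bx+2d≤n cy cz =
    x , d , 1≤x , 1≤d , <⇒≢ x<y , <⇒≢ (<-trans x<y y<z) , <⇒≢ y<z ,
    bx+2d≤n , ≤-trans (<⇒≤ y<z) bx+2d≤n , cy , cz
    where
    x<y : x < a * x + d
    x<y = ≤-<-trans (m≤n*m x a {{>-nonZero 1≤a}}) (m<m+n (a * x) 1≤d)
    y<z : a * x + d < b * x + 2 * d
    y<z = +-mono-≤-< (*-monoˡ-≤ x a≤b) (m<m+n d (≤-trans 1≤d (m≤m+n d 0)))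

  monoTriple-thirdTerm : ∀ {n r} (c : ℕ → Fin r) {x y} → a ≤ b → 1 ≤ x → a * x < y →
                         thirdTerm a b x y ≤ n → c y ≡ c x → c (thirdTerm a b x y) ≡ c x →
                         MonoTriple a b n r c
  monoTriple-thirdTerm c a≤b 1≤x ax<y third≤n cy cz =
    monoTriple c a≤b 1≤x (m<n⇒0<n∸m ax<y) third≤n (trans (cong c (m+[n∸m]≡n (<⇒≤ ax<y))) cy) cz

  monoTriple? : ∀ n {r} (c : ℕ → Fin r) → Dec (MonoTriple a b n r c)
  monoTriple? n c = map′ (λ (x , _ , d , _ , t) → x , d , t) bounded
    (anyUpTo? (λ x → anyUpTo? (λ d → conditions? x d) (suc n)) (suc n))
    where
    conditions? : ∀ x d → Dec (MonoTripleAt a b n _ c x d)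
    conditions? x d =
      1 ≤? x ×-dec 1 ≤? d ×-dec ¬? (x ≟ a * x + d) ×-dec ¬? (x ≟ b * x + 2 * d)
      ×-dec ¬? (a * x + d ≟ b * x + 2 * d) ×-dec b * x + 2 * d ≤? n ×-dec a * x + d ≤? n
      ×-dec c (a * x + d) Finₚ.≟ c x ×-dec c (b * x + 2 * d) Finₚ.≟ c x
    bounded : MonoTriple a b n _ c →
              ∃ λ x → x < suc n × ∃ λ d → d < suc n × MonoTripleAt a b n _ c x d
    bounded (x , d , t@(_ , _ , _ , _ , _ , _ , ax+d≤n , _)) =
      x , s≤s (≤-trans (x≤ax+d x d) ax+d≤n) , d , s≤s (≤-trans (m≤n+m d (a * x)) ax+d≤n) , t

  monoTriple-cong : ∀ {n r} {c c′ : ℕ → Fin r} → (∀ {i} → i ≤ n → c i ≡ c′ i) →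
                    MonoTriple a b n r c → MonoTriple a b n r c′
  monoTriple-cong {n} c≗c′ (x , d , 1≤x , 1≤d , x≢y , x≢z , y≢z , bx+2d≤n , ax+d≤n , cy , cz) =
    x , d , 1≤x , 1≤d , x≢y , x≢z , y≢z , bx+2d≤n , ax+d≤n ,
    trans (sym (c≗c′ ax+d≤n)) (trans cy (c≗c′ x≤n)) , trans (sym (c≗c′ bx+2d≤n)) (trans cz (c≗c′ x≤n))
    where
    x≤n : x ≤ n
    x≤n = ≤-trans (x≤ax+d x d) ax+d≤n

∀-vec? : ∀ {r} m {P : Vec (Fin r) m → Set} → (∀ v → Dec (P v)) → Dec (∀ v → P v)
∀-vec? zero    P? = map′ (λ { p [] → p }) (λ p → p []) (P? [])
∀-vec? (suc m) P? = map′ (λ { p (i ∷ v) → p i v }) (λ p i v → p (i ∷ v))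
  (Finₚ.all? λ i → ∀-vec? m λ v → P? (i ∷ v))

clamp : ∀ n → ℕ → Fin (suc n)
clamp n i = fromℕ< (s≤s (m⊓n≤n i n))

toℕ-clamp : ∀ {n i} → i ≤ n → toℕ (clamp n i) ≡ i
toℕ-clamp {n} {i} i≤n = trans (Finₚ.toℕ-fromℕ< (s≤s (m⊓n≤n i n))) (m≤n⇒m⊓n≡m i≤n)

-- A colouring of [1,n] is a vector of colours, read through clamp.
forces? : ∀ {a b} → 1 ≤ a → ∀ n r → Dec (Forces a b r n)
forces? {a} {b} 1≤a n r = map′ from (λ forces v → forces (lookup v ∘ clamp n))
  (∀-vec? (suc n) (λ v → monoTriple? {b = b} 1≤a n (lookup v ∘ clamp n)))
  where
  from : (∀ v → MonoTriple a b n r (lookup v ∘ clamp n)) → Forces a b r n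
  from all c = monoTriple-cong {b = b} 1≤a agree (all (tabulate (c ∘ toℕ)))
    where
    agree : ∀ {i} → i ≤ n → lookup (tabulate (c ∘ toℕ)) (clamp n i) ≡ c i
    agree i≤n = trans (lookup∘tabulate (c ∘ toℕ) _) (cong c (toℕ-clamp i≤n))

forces-mono : ∀ {a b r m m′} → m ≤ m′ → Forces a b r m → Forces a b r m′
forces-mono m≤m′ forces c with forces c
... | x , d , 1≤x , 1≤d , x≢y , x≢z , y≢z , z≤m , y≤m , cy , cz =
  x , d , 1≤x , 1≤d , x≢y , x≢z , y≢z , ≤-trans z≤m m≤m′ , ≤-trans y≤m m≤m′ , cy , cz

forces-positive : ∀ {a b r n} → Forces a b (suc r) n → 1 ≤ n
forces-positive {a} forces with forces (λ _ → 0F)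
... | x , d , _ , 1≤d , _ , _ , _ , _ , ax+d≤n , _ = ≤-trans 1≤d (≤-trans (m≤n+m d (a * x)) ax+d≤n)

forces-from-¬¬ : ∀ {a b r n} → 1 ≤ a → (∀ c → ¬ ¬ MonoTriple a b n r c) → Forces a b r n
forces-from-¬¬ {b = b} 1≤a ¬¬mono c = decidable-stable (monoTriple? {b = b} 1≤a _ c) (¬¬mono c)

module _ {p} {P : ℕ → Set p} (P? : U.Decidable P) where

  minimal-below : ∀ v → (∃ λ n → n < v × P n) → ∃ λ m → P m × m < v × (∀ {k} → P k → m ≤ k)
  minimal-below (suc v) (n , n<1+v , Pn) with anyUpTo? P? v
  ... | yes below = let m , Pm , m<v , minimal = minimal-below v below in
                    m , Pm , m<n⇒m<1+n m<v , minimal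
  ... | no ¬below = n , Pn , n<1+v ,
                    λ Pk → ≤-trans (m<1+n⇒m≤n n<1+v) (≮⇒≥ λ k<v → ¬below (_ , k<v , Pk))

N-below : ∀ {a b r n} → 1 ≤ a → Forces a b (suc r) n → ∃ λ N → IsN a b (suc r) N × N ≤ n
N-below {a} {b} {r} {n} 1≤a forces
  with minimal-below (λ m → forces? {b = b} 1≤a m (suc r)) (suc n) (n , ≤-refl , forces)
... | N , forcesN , N<1+n , minimal =
  N , (forces-positive {a} {b} forcesN , forcesN , λ _ _ → minimal) , m<1+n⇒m≤n N<1+n

≢-≢⇒≡ : {i j k : Fin 2} → i ≢ k → j ≢ k → i ≡ j
≢-≢⇒≡ {0F}      {0F}               _   _   = refl
≢-≢⇒≡ {sucF 0F} {sucF 0F}          _   _   = refl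
≢-≢⇒≡ {0F}      {sucF 0F} {0F}      i≢k _   = ⊥-elim (i≢k refl)
≢-≢⇒≡ {0F}      {sucF 0F} {sucF 0F} _   j≢k = ⊥-elim (j≢k refl)
≢-≢⇒≡ {sucF 0F} {0F}      {0F}      _   j≢k = ⊥-elim (j≢k refl)
≢-≢⇒≡ {sucF 0F} {0F}      {sucF 0F} i≢k _   = ⊥-elim (i≢k refl)

module Avoiding {a b n : ℕ} (1≤a : 1 ≤ a) (a≤b : a ≤ b) (c : ℕ → Fin 2)
                (noMono : ¬ MonoTriple a b n 2 c) where

  avoid : ∀ {x y} → 1 ≤ x → a * x < y → thirdTerm a b x y ≤ n →
          c y ≡ c x → c (thirdTerm a b x y) ≢ c x
  avoid 1≤x ax<y third≤n cy cz = noMono (monoTriple-thirdTerm 1≤a c a≤b 1≤x ax<y third≤n cy cz)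

  two-colours-in-triple : ∀ {x d} → 1 ≤ x → 1 ≤ d → b * x + 2 * d ≤ n →
                          c x ≢ c (a * x + d) ⊎ c (a * x + d) ≢ c (b * x + 2 * d)
  two-colours-in-triple 1≤x 1≤d bx+2d≤n with c (a * _ + _) Finₚ.≟ c _
  ... | yes cy = inj₂ λ cy≡cz → noMono (monoTriple 1≤a c a≤b 1≤x 1≤d bx+2d≤n cy (trans (sym cy≡cz) cy))
  ... | no cy≢cx = inj₁ (cy≢cx ∘ sym)

  module Propagation (p q D T : ℕ) (1≤p : 1 ≤ p) (1≤q : 1 ≤ q) (ap<T : a * p < T) (aq<T : a * q < T)
                     (cp≢cq : c p ≢ c q)
                     (shift : ∀ {y} → T ≤ y → thirdTerm a b p y ≡ thirdTerm a b q (y + D)) where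

    private
      f : ℕ → ℕ
      f = thirdTerm a b p

      ap≤ : ∀ {y} → T ≤ y → a * p ≤ y
      ap≤ T≤y = <⇒≤ (<-≤-trans ap<T T≤y)

      orbit : ∀ {y J} → T ≤ y → f y ≡ y + J → ∀ v → f (y + v) ≡ y + (J + 2 * v)
      orbit {y} {J} T≤y fy≡ v =
        trans (thirdTerm-+ a b p v (ap≤ T≤y)) (trans (cong (_+ 2 * v) fy≡) (+-assoc y J (2 * v)))

      f³≡ : ∀ {y J} → T ≤ y → f y ≡ y + J → f (f (f y)) ≡ y + 7 * J
      f³≡ {y} {J} T≤y fy≡ = begin
        f (f (f y))               ≡⟨ cong (f ∘ f) fy≡ ⟩
        f (f (y + J))             ≡⟨ cong f (orbit T≤y fy≡ J) ⟩
        f (y + (J + 2 * J))       ≡⟨ orbit T≤y fy≡ (J + 2 * J) ⟩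
        y + (J + 2 * (J + 2 * J)) ≡⟨ cong (y +_) (seven J) ⟩
        y + 7 * J                 ∎
        where
        open ≡-Reasoning
        seven : ∀ J → J + 2 * (J + 2 * J) ≡ 7 * J
        seven = solve-∀

    colour-persists : ∀ {y} → T ≤ y → f y ≤ n → c y ≡ c p → c (y + D) ≡ c p
    colour-persists {y} T≤y fy≤n cy = ≢-≢⇒≡ cyD≢cq cp≢cq
      where
      cfy≡cq : c (f y) ≡ c q
      cfy≡cq = ≢-≢⇒≡ (avoid 1≤p (<-≤-trans ap<T T≤y) fy≤n cy) (cp≢cq ∘ sym)
      cyD≢cq : c (y + D) ≢ c q
      cyD≢cq cyD = avoid 1≤q (<-≤-trans aq<T (≤-trans T≤y (m≤m+n y D)))
        (subst (_≤ n) (shift T≤y) fy≤n) cyD (trans (cong c (sym (shift T≤y))) cfy≡cq)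

    colour-persists* : ∀ j {y} → T ≤ y → f (y + j * D) ≤ n → c y ≡ c p → c (y + j * D) ≡ c p
    colour-persists* zero    {y} _   _  cy = trans (cong c (+-identityʳ y)) cy
    colour-persists* (suc j) {y} T≤y ≤n cy =
      subst (λ z → c z ≡ c p) (+-assoc y D (j * D))
        (colour-persists* j (≤-trans T≤y (m≤m+n y D))
          (subst (λ z → f z ≤ n) (sym (+-assoc y D (j * D))) ≤n)
          (colour-persists T≤y (≤-trans (thirdTerm-mono a b p (m≤m+n y (suc j * D))) ≤n) cy))

    not-periodic : ∀ j {y} → T ≤ y → f y ≡ y + j * D → f (f y) ≤ n → c y ≢ c p
    not-periodic j {y} T≤y fy≡ ffy≤n cy =
      avoid 1≤p (<-≤-trans ap<T T≤y) fy≤n cy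
        (subst (λ z → c z ≡ c p) (sym fy≡)
          (colour-persists* j T≤y (subst (λ z → f z ≤ n) fy≡ ffy≤n) cy))
      where
      fy≤n : f y ≤ n
      fy≤n = ≤-trans (thirdTerm-mono a b p (≤-thirdTerm p a≤b (ap≤ T≤y))) ffy≤n

    -- Whichever colour y + D has, one of y + D and f y is a point of colour c p whose
    -- orbit returns to its residue class modulo D.
    no-orbit : ∀ j {y} → T ≤ y → f y ≡ y + suc j * D → y + 7 * (suc j * D) ≤ n → ⊥
    no-orbit j {y} T≤y fy≡ bound = not-periodic (2 * suc j) T≤fy ffy≡ fffy≤n (≢-≢⇒≡ cfy≢cq cp≢cq)
      where
      J : ℕ
      J = suc j * D
      T≤fy : T ≤ f y
      T≤fy = ≤-trans T≤y (≤-thirdTerm p a≤b (ap≤ T≤y))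
      fffy≤n : f (f (f y)) ≤ n
      fffy≤n = subst (_≤ n) (sym (f³≡ T≤y fy≡)) bound
      ffy≡ : f (f y) ≡ f y + 2 * suc j * D
      ffy≡ = trans (cong f fy≡) (trans (orbit T≤y fy≡ J) (trans (sym (+-assoc y J (2 * J)))
               (cong₂ _+_ (sym fy≡) (sym (*-assoc 2 (suc j) D)))))
      y+D≤fy : y + D ≤ f y
      y+D≤fy = subst (y + D ≤_) (sym fy≡) (+-monoʳ-≤ y (m≤m+n D (j * D)))
      cy+D≢cp : c (y + D) ≢ c p
      cy+D≢cp = not-periodic (suc (suc j)) (≤-trans T≤y (m≤m+n y D))
        (trans (orbit T≤y fy≡ D) (rearrange y j D))
        (≤-trans (thirdTerm-mono a b p (thirdTerm-mono a b p y+D≤fy)) fffy≤n)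
        where
        rearrange : ∀ y j D → y + (suc j * D + 2 * D) ≡ y + D + suc (suc j) * D
        rearrange = solve-∀
      fy≤n : f y ≤ n
      fy≤n = ≤-trans (≤-trans (≤-reflexive fy≡) (+-monoʳ-≤ y (m≤n*m J 7))) bound
      cfy≢cq : c (f y) ≢ c q
      cfy≢cq cfy = avoid 1≤q (<-≤-trans aq<T (≤-trans T≤y (m≤m+n y D))) (subst (_≤ n) (shift T≤y) fy≤n)
        (≢-≢⇒≡ cy+D≢cp (cp≢cq ∘ sym)) (trans (cong c (sym (shift T≤y))) cfy)

thirdTerm-above : ∀ a k x {y} → a * x ≤ y → thirdTerm a (2 * a + k) x y ≡ 2 * y + k * x
thirdTerm-above a k x {y} ax≤y =
  trans (rearrange a k x (y ∸ a * x)) (cong (λ v → 2 * v + k * x) (m+[n∸m]≡n ax≤y))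
  where
  rearrange : ∀ a k x d → (2 * a + k) * x + 2 * d ≡ 2 * (a * x + d) + k * x
  rearrange = solve-∀

-- With p = u + 2s and q = u, the orbit of y = k t under thirdTerm p is y ↦ 2y + kp, which
-- moves y by a multiple of D = k s exactly when s divides t + p.
pair-above : ∀ {a k n} (c : ℕ → Fin 2) → 1 ≤ a → 1 ≤ k → ¬ MonoTriple a (2 * a + k) n 2 c →
             ∀ {u s t j} → 1 ≤ u → c u ≢ c (u + 2 * s) → t + (u + 2 * s) ≡ suc j * s →
             a * (u + 2 * s) < t → k * (8 * t + 7 * (u + 2 * s)) ≤ n → ⊥
pair-above {a} {k} {n} c 1≤a 1≤k noMono {u} {s} {t} {j} 1≤u cu≢cp t+p≡ ap<t bound =
  no-orbit j T≤kt orbit (subst (_≤ n) bound≡ bound)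
  where
  open ≡-Reasoning
  p : ℕ
  p = u + 2 * s
  au<T : a * u < suc (a * p)
  au<T = s≤s (*-monoʳ-≤ a (m≤m+n u (2 * s)))
  shift : ∀ {y} → suc (a * p) ≤ y → thirdTerm a (2 * a + k) p y ≡ thirdTerm a (2 * a + k) u (y + k * s)
  shift {y} T≤y = begin
    thirdTerm a (2 * a + k) p y           ≡⟨ thirdTerm-above a k p (<⇒≤ T≤y) ⟩
    2 * y + k * (u + 2 * s)               ≡⟨ rearrange y k u s ⟩
    2 * (y + k * s) + k * u               ≡⟨ sym (thirdTerm-above a k u au≤y+ks) ⟩
    thirdTerm a (2 * a + k) u (y + k * s) ∎
    where
    rearrange : ∀ y k u s → 2 * y + k * (u + 2 * s) ≡ 2 * (y + k * s) + k * u
    rearrange = solve-∀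
    au≤y+ks : a * u ≤ y + k * s
    au≤y+ks = ≤-trans (<⇒≤ (<-≤-trans au<T T≤y)) (m≤m+n y (k * s))
  open Avoiding 1≤a (≤-trans (m≤m+n a (a + 0)) (m≤m+n (2 * a) k)) c noMono
  open Propagation p u (k * s) (suc (a * p)) (≤-trans 1≤u (m≤m+n u (2 * s))) 1≤u ≤-refl au<T
                   (cu≢cp ∘ sym) shift
  T≤kt : suc (a * p) ≤ k * t
  T≤kt = ≤-trans ap<t (m≤n*m t k {{>-nonZero 1≤k}})
  orbit : thirdTerm a (2 * a + k) p (k * t) ≡ k * t + suc j * (k * s)
  orbit = begin
    thirdTerm a (2 * a + k) p (k * t) ≡⟨ thirdTerm-above a k p (<⇒≤ T≤kt) ⟩
    2 * (k * t) + k * p               ≡⟨ split k t p ⟩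
    k * t + k * (t + p)               ≡⟨ cong (λ v → k * t + k * v) t+p≡ ⟩
    k * t + k * (suc j * s)           ≡⟨ swap k t (suc j) s ⟩
    k * t + suc j * (k * s)           ∎
    where
    split : ∀ k t p → 2 * (k * t) + k * p ≡ k * t + k * (t + p)
    split = solve-∀
    swap : ∀ k t m s → k * t + k * (m * s) ≡ k * t + m * (k * s)
    swap = solve-∀
  bound≡ : k * (8 * t + 7 * p) ≡ k * t + 7 * (suc j * (k * s))
  bound≡ = begin
    k * (8 * t + 7 * p)          ≡⟨ split k t p ⟩
    k * t + 7 * (k * (t + p))    ≡⟨ cong (λ v → k * t + 7 * (k * v)) t+p≡ ⟩
    k * t + 7 * (k * (suc j * s)) ≡⟨ swap k t (suc j) s ⟩
    k * t + 7 * (suc j * (k * s)) ∎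
    where
    split : ∀ k t p → k * (8 * t + 7 * p) ≡ k * t + 7 * (k * (t + p))
    split = solve-∀
    swap : ∀ k t m s → k * t + 7 * (k * (m * s)) ≡ k * t + 7 * (m * (k * s))
    swap = solve-∀

thirdTerm-below : ∀ k e x {y} → (k + e) * x ≤ y → thirdTerm (k + e) (k + 2 * e) x y + k * x ≡ 2 * y
thirdTerm-below k e x {y} ax≤y =
  trans (rearrange k e x (y ∸ (k + e) * x)) (cong (2 *_) (m+[n∸m]≡n ax≤y))
  where
  rearrange : ∀ k e x d → (k + 2 * e) * x + 2 * d + k * x ≡ 2 * ((k + e) * x + d)
  rearrange = solve-∀

-- With p = u and q = u + 2s, the orbit of y under thirdTerm p is y ↦ 2y − ku, which moves
-- y = k (u + m s) by m k s.
pair-below : ∀ {k e n} (c : ℕ → Fin 2) → 1 ≤ k → ¬ MonoTriple (k + e) (k + 2 * e) n 2 c →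
             ∀ {u s j} → 1 ≤ u → c u ≢ c (u + 2 * s) →
             (k + e) * (u + 2 * s) < k * (u + suc j * s) → k * (u + 8 * (suc j * s)) ≤ n → ⊥
pair-below {k} {e} {n} c 1≤k noMono {u} {s} {j} 1≤u cu≢cq aq<y bound =
  no-orbit j aq<y orbit (subst (_≤ n) (bound≡ k u (suc j) s) bound)
  where
  open ≡-Reasoning
  a b q y : ℕ
  a = k + e
  b = k + 2 * e
  q = u + 2 * s
  y = k * (u + suc j * s)
  au<T : a * u < suc (a * q)
  au<T = s≤s (*-monoʳ-≤ a (m≤m+n u (2 * s)))
  shift : ∀ {y} → suc (a * q) ≤ y → thirdTerm a b u y ≡ thirdTerm a b q (y + k * s)
  shift {y} T≤y = +-cancelʳ-≡ (k * u) _ _ (trans (thirdTerm-below k e u au≤y) (sym F+ku≡2y))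
    where
    F : ℕ
    F = thirdTerm a b q (y + k * s)
    au≤y : a * u ≤ y
    au≤y = <⇒≤ (<-≤-trans au<T T≤y)
    F+ku≡2y : F + k * u ≡ 2 * y
    F+ku≡2y = +-cancelʳ-≡ (2 * (k * s)) _ _ (begin
      F + k * u + 2 * (k * s) ≡⟨ regroup F k u s ⟨
      F + k * q               ≡⟨ thirdTerm-below k e q (≤-trans (<⇒≤ T≤y) (m≤m+n y (k * s))) ⟩
      2 * (y + k * s)         ≡⟨ *-distribˡ-+ 2 y (k * s) ⟩
      2 * y + 2 * (k * s)     ∎)
      where
      regroup : ∀ F k u s → F + k * (u + 2 * s) ≡ F + k * u + 2 * (k * s)
      regroup = solve-∀
  open Avoiding (≤-trans 1≤k (m≤m+n k e)) (+-monoʳ-≤ k (m≤m+n e (e + 0))) c noMono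
  open Propagation u q (k * s) (suc (a * q)) 1≤u (≤-trans 1≤u (m≤m+n u (2 * s))) au<T ≤-refl
                   cu≢cq shift
  orbit : thirdTerm a b u y ≡ y + suc j * (k * s)
  orbit = +-cancelʳ-≡ (k * u) _ _
    (trans (thirdTerm-below k e u (≤-trans (*-monoʳ-≤ a (m≤m+n u (2 * s))) (<⇒≤ aq<y)))
           (double k u (suc j) s))
    where
    double : ∀ k u m s → 2 * (k * (u + m * s)) ≡ k * (u + m * s) + m * (k * s) + k * u
    double = solve-∀
  bound≡ : ∀ k u m s → k * (u + 8 * (m * s)) ≡ k * (u + m * s) + 7 * (m * (k * s))
  bound≡ = solve-∀

bound₁ bound₂ : ℕ → ℕ → ℕ
bound₁ a b = 4 * a * ((b ^ 3 + b ^ 2) ∸ (3 * b + 3)) + 2 * b ^ 3 + 6 * b ^ 2 + 6 * b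
bound₂ a b = 4 * a * (b ^ 3 + 2 * b ^ 2 + 2 * b) ∸ 4 * b ^ 2

≤-from-slack : ∀ {m n} r → m + r ≡ n → m ≤ n
≤-from-slack {m} r m+r≡n = subst (m ≤_) m+r≡n (m≤m+n m r)

bound₁-≡ : ∀ a b {X} → b ^ 3 + b ^ 2 ≡ 3 * b + 3 + X →
           bound₁ a b ≡ 4 * a * X + 2 * b ^ 3 + 6 * b ^ 2 + 6 * b
bound₁-≡ a b {X} eq =
  cong (λ v → 4 * a * v + 2 * b ^ 3 + 6 * b ^ 2 + 6 * b)
       (trans (cong (_∸ (3 * b + 3)) eq) (m+n∸m≡n (3 * b + 3) X))

bound₂-≡ : ∀ a b {Y} → 4 * a * (b ^ 3 + 2 * b ^ 2 + 2 * b) ≡ 4 * b ^ 2 + Y → bound₂ a b ≡ Y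
bound₂-≡ a b {Y} eq = trans (cong (_∸ 4 * b ^ 2) eq) (m+n∸m≡n (4 * b ^ 2) Y)

-- The polynomial identities below are certificates: each slack term has nonnegative coefficients.

bound₁-closed : ∀ α κ → bound₁ (suc α) (2 * suc α + suc κ) ≡
  222 + 528 * α + 216 * κ + 496 * α * α + 376 * α * κ + 64 * κ * κ + 208 * α * α * α
  + 232 * α * α * κ + 76 * α * κ * κ + 6 * κ * κ * κ + 32 * α * α * α * α + 48 * α * α * α * κ
  + 24 * α * α * κ * κ + 4 * α * κ * κ * κ
bound₁-closed α κ = trans (bound₁-≡ (suc α) (2 * suc α + suc κ) (cubic α κ)) (expand α κ)
  where
  cubic : ∀ α κ →
    (2 * suc α + suc κ) * ((2 * suc α + suc κ) * ((2 * suc α + suc κ) * 1))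
    + (2 * suc α + suc κ) * ((2 * suc α + suc κ) * 1) ≡
    3 * (2 * suc α + suc κ) + 3 + (24 + 60 * α + 30 * κ + 40 * α * α + 40 * α * κ + 10 * κ * κ
    + 8 * α * α * α + 12 * α * α * κ + 6 * α * κ * κ + κ * κ * κ)
  cubic = solve-∀
  expand : ∀ α κ →
    4 * suc α * (24 + 60 * α + 30 * κ + 40 * α * α + 40 * α * κ + 10 * κ * κ + 8 * α * α * α
    + 12 * α * α * κ + 6 * α * κ * κ + κ * κ * κ)
    + 2 * ((2 * suc α + suc κ) * ((2 * suc α + suc κ) * ((2 * suc α + suc κ) * 1)))
    + 6 * ((2 * suc α + suc κ) * ((2 * suc α + suc κ) * 1)) + 6 * (2 * suc α + suc κ) ≡
    222 + 528 * α + 216 * κ + 496 * α * α + 376 * α * κ + 64 * κ * κ + 208 * α * α * α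
    + 232 * α * α * κ + 76 * α * κ * κ + 6 * κ * κ * κ + 32 * α * α * α * α + 48 * α * α * α * κ
    + 24 * α * α * κ * κ + 4 * α * κ * κ * κ
  expand = solve-∀

-- Orbit data for the pair (2, 2a + 2), where a = 1 + α and b = 2a + 1 + κ.
above-pair₁ : ∀ α κ → let a = suc α; p = 2 + 2 * a in ∃₂ λ t j →
  t + p ≡ suc j * a × a * p < t × suc κ * (8 * t + 7 * p) ≤ bound₁ a (2 * a + suc κ)
above-pair₁ α κ = 5 + 9 * α + 2 * α * α , 2 * suc α + 6 ,
  divides α , ≤-from-slack (3 * α) (start α) ,
  ≤-from-slack _ (trans (slack α κ) (sym (bound₁-closed α κ)))
  where
  divides : ∀ α → 5 + 9 * α + 2 * α * α + (2 + 2 * suc α) ≡ suc (2 * suc α + 6) * suc α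
  divides = solve-∀
  start : ∀ α → suc (suc α * (2 + 2 * suc α)) + 3 * α ≡ 5 + 9 * α + 2 * α * α
  start = solve-∀
  slack : ∀ α κ → suc κ * (8 * (5 + 9 * α + 2 * α * α) + 7 * (2 + 2 * suc α))
    + (154 + 442 * α + 148 * κ + 480 * α * α + 290 * α * κ + 64 * κ * κ + 208 * α * α * α
    + 216 * α * α * κ + 76 * α * κ * κ + 6 * κ * κ * κ + 32 * α * α * α * α + 48 * α * α * α * κ
    + 24 * α * α * κ * κ + 4 * α * κ * κ * κ) ≡
    222 + 528 * α + 216 * κ + 496 * α * α + 376 * α * κ + 64 * κ * κ + 208 * α * α * α
    + 232 * α * α * κ + 76 * α * κ * κ + 6 * κ * κ * κ + 32 * α * α * α * α + 48 * α * α * α * κ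
    + 24 * α * α * κ * κ + 4 * α * κ * κ * κ
  slack = solve-∀

-- Orbit data for the pair (2a + 2, 2b + 4).
above-pair₂ : ∀ α κ → let a = suc α; s = a + suc κ + 1; p = a * 2 + 2 + 2 * s in ∃₂ λ t j →
  t + p ≡ suc j * s × a * p < t × suc κ * (8 * t + 7 * p) ≤ bound₁ a (2 * a + suc κ)
above-pair₂ α κ = 11 + 15 * α + 5 * κ + 4 * α * α + 4 * α * κ , 4 * suc α + 2 ,
  divides α κ , ≤-from-slack _ (start α κ) ,
  ≤-from-slack _ (trans (slack α κ) (sym (bound₁-closed α κ)))
  where
  divides : ∀ α κ → 11 + 15 * α + 5 * κ + 4 * α * α + 4 * α * κ
    + (suc α * 2 + 2 + 2 * (suc α + suc κ + 1)) ≡ suc (4 * suc α + 2) * (suc α + suc κ + 1)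
  divides = solve-∀
  start : ∀ α κ → suc (suc α * (suc α * 2 + 2 + 2 * (suc α + suc κ + 1))) + (α + 3 * κ + 2 * α * κ)
    ≡ 11 + 15 * α + 5 * κ + 4 * α * α + 4 * α * κ
  start = solve-∀
  slack : ∀ α κ → suc κ * (8 * (11 + 15 * α + 5 * κ + 4 * α * α + 4 * α * κ)
    + 7 * (suc α * 2 + 2 + 2 * (suc α + suc κ + 1)))
    + (64 + 380 * α + 4 * κ + 464 * α * α + 196 * α * κ + 10 * κ * κ + 208 * α * α * α
    + 200 * α * α * κ + 44 * α * κ * κ + 6 * κ * κ * κ + 32 * α * α * α * α + 48 * α * α * α * κ
    + 24 * α * α * κ * κ + 4 * α * κ * κ * κ) ≡
    222 + 528 * α + 216 * κ + 496 * α * α + 376 * α * κ + 64 * κ * κ + 208 * α * α * α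
    + 232 * α * α * κ + 76 * α * κ * κ + 6 * κ * κ * κ + 32 * α * α * α * α + 48 * α * α * α * κ
    + 24 * α * α * κ * κ + 4 * α * κ * κ * κ
  slack = solve-∀

≤-orbitBound-above : ∀ {k} t p → 1 ≤ k → p ≤ k * (8 * t + 7 * p)
≤-orbitBound-above {k} t p 1≤k =
  ≤-trans (m≤n*m p 7) (≤-trans (m≤n+m (7 * p) (8 * t)) (m≤n*m _ k {{>-nonZero 1≤k}}))

forces-above-diagonal′ : ∀ α κ →
  Forces (suc α) (2 * suc α + suc κ) 2 (bound₁ (suc α) (2 * suc α + suc κ))
forces-above-diagonal′ α κ = forces-from-¬¬ {b = b} {n = bound₁ a b} 1≤a λ c noMono →
  [ (λ c2≢cy → let t , j , divides , start , bound = above-pair₁ α κ in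
      pair-above c 1≤a 1≤k noMono {u = 2} {a} {t} {j} (s≤s z≤n) (subst (λ v → c 2 ≢ c v) y≡p₁ c2≢cy)
                 divides start bound)
  , (λ cy≢cz → let t , j , divides , start , bound = above-pair₂ α κ in
      pair-above c 1≤a 1≤k noMono {u = y} {s} {t} {j} (s≤s z≤n) (subst (λ v → c y ≢ c v) z≡p₂ cy≢cz)
                 divides start bound)
  ]′ (Avoiding.two-colours-in-triple 1≤a a≤b c noMono (s≤s z≤n) (s≤s z≤n) third≤bound)
  where
  a k b y s : ℕ
  a = suc α
  k = suc κ
  b = 2 * a + k
  y = a * 2 + 2
  s = a + k + 1
  1≤a : 1 ≤ a
  1≤a = s≤s z≤n
  1≤k : 1 ≤ k
  1≤k = s≤s z≤n
  a≤b : a ≤ b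
  a≤b = ≤-trans (m≤m+n a (a + 0)) (m≤m+n (2 * a) k)
  y≡p₁ : y ≡ 2 + 2 * a
  y≡p₁ = rearrange α
    where
    rearrange : ∀ α → suc α * 2 + 2 ≡ 2 + 2 * suc α
    rearrange = solve-∀
  z≡p₂ : b * 2 + 2 * 2 ≡ y + 2 * s
  z≡p₂ = rearrange α κ
    where
    rearrange : ∀ α κ → (2 * suc α + suc κ) * 2 + 2 * 2 ≡ suc α * 2 + 2 + 2 * (suc α + suc κ + 1)
    rearrange = solve-∀
  third≤bound : b * 2 + 2 * 2 ≤ bound₁ a b
  third≤bound = let t , _ , _ , _ , bound = above-pair₂ α κ in
    subst (_≤ bound₁ a b) (sym z≡p₂) (≤-trans (≤-orbitBound-above t (y + 2 * s) 1≤k) bound)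

forces-above-diagonal : ∀ {a b} → 1 ≤ a → 2 * a < b → Forces a b 2 (bound₁ a b)
forces-above-diagonal {suc α} (s≤s z≤n) 2a<b with m≤n⇒∃[o]m+o≡n 2a<b
... | κ , 2a+1+κ≡b = subst (λ b → Forces (suc α) b 2 (bound₁ (suc α) b))
                          (trans (+-suc (2 * suc α) κ) 2a+1+κ≡b) (forces-above-diagonal′ α κ)

orbitBound-below : (k e u s : ℕ) → ℕ
orbitBound-below k e u s = k * (u + 8 * (suc (e * (u + 2 * s) + 2) * s))

≤-orbitBound-below : ∀ {k} e u s → 1 ≤ k → u + 2 * s ≤ orbitBound-below k e u s
≤-orbitBound-below {k} e u s 1≤k = ≤-trans
  (+-monoʳ-≤ u (*-mono-≤ (m≤m+n 2 6) (m≤n*m s (suc (e * (u + 2 * s) + 2)))))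
  (m≤n*m _ k {{>-nonZero 1≤k}})

below-orbit-start : ∀ {k e s} u → 1 ≤ k → 1 ≤ s →
              (k + e) * (u + 2 * s) < k * (u + suc (e * (u + 2 * s) + 2) * s)
below-orbit-start {suc κ} {e} {suc σ} u _ _ = ≤-from-slack _ (slack κ σ e u)
  where
  slack : ∀ κ σ e u → suc ((suc κ + e) * (u + 2 * suc σ)) + (e * (u + 2 * suc σ) + 1) * (κ * σ + κ + σ)
          ≡ suc κ * (u + suc (e * (u + 2 * suc σ) + 2) * suc σ)
  slack = solve-∀

forces-below-by-pairs : ∀ {k e n} → 1 ≤ k → orbitBound-below k e 2 (k + e) ≤ n →
                        orbitBound-below k e ((k + e) * 2 + 2) (suc e) ≤ n →
                        Forces (k + e) (k + 2 * e) 2 n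
forces-below-by-pairs {k} {e} {n} 1≤k pair₁≤n pair₂≤n = forces-from-¬¬ {b = b} 1≤a λ c noMono →
  [ (λ c2≢cy → pair-below c 1≤k noMono {u = 2} {a} {e * (2 + 2 * a) + 2} (s≤s z≤n)
                 (subst (λ v → c 2 ≢ c v) y≡q₁ c2≢cy) (below-orbit-start 2 1≤k 1≤a) pair₁≤n)
  , (λ cy≢cz → pair-below c 1≤k noMono {u = y} {suc e} {j₂} 1≤y
                 (subst (λ v → c y ≢ c v) z≡q₂ cy≢cz) (below-orbit-start y 1≤k (s≤s z≤n)) pair₂≤n)
  ]′ (Avoiding.two-colours-in-triple 1≤a a≤b c noMono (s≤s z≤n) (s≤s z≤n) third≤n)
  where
  a b y j₂ : ℕ
  a = k + e
  b = k + 2 * e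
  y = a * 2 + 2
  j₂ = e * (y + 2 * suc e) + 2
  1≤a : 1 ≤ a
  1≤a = ≤-trans 1≤k (m≤m+n k e)
  a≤b : a ≤ b
  a≤b = +-monoʳ-≤ k (m≤m+n e (e + 0))
  1≤y : 1 ≤ y
  1≤y = ≤-trans (s≤s z≤n) (m≤n+m 2 (a * 2))
  y≡q₁ : y ≡ 2 + 2 * a
  y≡q₁ = rearrange a
    where
    rearrange : ∀ a → a * 2 + 2 ≡ 2 + 2 * a
    rearrange = solve-∀
  z≡q₂ : b * 2 + 2 * 2 ≡ y + 2 * suc e
  z≡q₂ = rearrange k e
    where
    rearrange : ∀ k e → (k + 2 * e) * 2 + 2 * 2 ≡ (k + e) * 2 + 2 + 2 * suc e
    rearrange = solve-∀
  third≤n : b * 2 + 2 * 2 ≤ n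
  third≤n = subst (_≤ n) (sym z≡q₂) (≤-trans (≤-orbitBound-below e y (suc e) 1≤k) pair₂≤n)

below-pair-bounds-a<b : ∀ κ ε → let k = suc κ; e = suc ε; a = k + e; B = bound₂ a (k + 2 * e) in
  orbitBound-below k e 2 a ≤ B × orbitBound-below k e (a * 2 + 2) (suc e) ≤ B
below-pair-bounds-a<b κ ε =
  ≤-from-slack _ (trans (slack₁ κ ε) (sym (bound₂-≡ (suc κ + suc ε) (suc κ + 2 * suc ε) (quartic κ ε)))) ,
  ≤-from-slack _ (trans (slack₂ κ ε) (sym (bound₂-≡ (suc κ + suc ε) (suc κ + 2 * suc ε) (quartic κ ε))))
  where
  quartic : ∀ κ ε →
    4 * (suc κ + suc ε) * ((suc κ + 2 * suc ε) * ((suc κ + 2 * suc ε) * ((suc κ + 2 * suc ε) * 1))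
    + 2 * ((suc κ + 2 * suc ε) * ((suc κ + 2 * suc ε) * 1)) + 2 * (suc κ + 2 * suc ε)) ≡
    4 * ((suc κ + 2 * suc ε) * ((suc κ + 2 * suc ε) * 1))
    + (372 + 812 * ε + 508 * κ + 664 * ε * ε + 828 * ε * κ + 248 * κ * κ + 240 * ε * ε * ε
    + 448 * ε * ε * κ + 268 * ε * κ * κ + 52 * κ * κ * κ + 32 * ε * ε * ε * ε + 80 * ε * ε * ε * κ
    + 72 * ε * ε * κ * κ + 28 * ε * κ * κ * κ + 4 * κ * κ * κ * κ)
  quartic = solve-∀
  slack₁ : ∀ κ ε → suc κ * (2 + 8 * (suc (suc ε * (2 + 2 * (suc κ + suc ε)) + 2) * (suc κ + suc ε)))
    + (226 + 612 * ε + 258 * κ + 568 * ε * ε + 516 * ε * κ + 128 * κ * κ + 224 * ε * ε * ε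
    + 320 * ε * ε * κ + 140 * ε * κ * κ + 36 * κ * κ * κ + 32 * ε * ε * ε * ε + 64 * ε * ε * ε * κ
    + 40 * ε * ε * κ * κ + 12 * ε * κ * κ * κ + 4 * κ * κ * κ * κ) ≡
    372 + 812 * ε + 508 * κ + 664 * ε * ε + 828 * ε * κ + 248 * κ * κ + 240 * ε * ε * ε
    + 448 * ε * ε * κ + 268 * ε * κ * κ + 52 * κ * κ * κ + 32 * ε * ε * ε * ε + 80 * ε * ε * ε * κ
    + 72 * ε * ε * κ * κ + 28 * ε * κ * κ * κ + 4 * κ * κ * κ * κ
  slack₁ = solve-∀
  slack₂ : ∀ κ ε → suc κ * ((suc κ + suc ε) * 2 + 2
    + 8 * (suc (suc ε * ((suc κ + suc ε) * 2 + 2 + 2 * suc (suc ε)) + 2) * suc (suc ε)))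
    + (158 + 482 * ε + 260 * κ + 488 * ε * ε + 450 * ε * κ + 214 * κ * κ + 208 * ε * ε * ε
    + 256 * ε * ε * κ + 220 * ε * κ * κ + 52 * κ * κ * κ + 32 * ε * ε * ε * ε + 48 * ε * ε * ε * κ
    + 56 * ε * ε * κ * κ + 28 * ε * κ * κ * κ + 4 * κ * κ * κ * κ) ≡
    372 + 812 * ε + 508 * κ + 664 * ε * ε + 828 * ε * κ + 248 * κ * κ + 240 * ε * ε * ε
    + 448 * ε * ε * κ + 268 * ε * κ * κ + 52 * κ * κ * κ + 32 * ε * ε * ε * ε + 80 * ε * ε * ε * κ
    + 72 * ε * ε * κ * κ + 28 * ε * κ * κ * κ + 4 * κ * κ * κ * κ
  slack₂ = solve-∀

below-pair-bounds-a≡b : ∀ κ → let k = suc (suc κ); a = k + 0; B = bound₂ a (k + 2 * 0) in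
  orbitBound-below k 0 2 a ≤ B × orbitBound-below k 0 (a * 2 + 2) 1 ≤ B
below-pair-bounds-a≡b κ =
  ≤-from-slack _ (trans (slack₁ κ) (sym (bound₂-≡ (2 + κ + 0) (2 + κ + 2 * 0) (quartic κ)))) ,
  ≤-from-slack _ (trans (slack₂ κ) (sym (bound₂-≡ (2 + κ + 0) (2 + κ + 2 * 0) (quartic κ))))
  where
  quartic : ∀ κ →
    4 * (suc (suc κ) + 0)
    * ((suc (suc κ) + 2 * 0) * ((suc (suc κ) + 2 * 0) * ((suc (suc κ) + 2 * 0) * 1))
    + 2 * ((suc (suc κ) + 2 * 0) * ((suc (suc κ) + 2 * 0) * 1)) + 2 * (suc (suc κ) + 2 * 0)) ≡
    4 * ((suc (suc κ) + 2 * 0) * ((suc (suc κ) + 2 * 0) * 1))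
    + (144 + 240 * κ + 148 * κ * κ + 40 * κ * κ * κ + 4 * κ * κ * κ * κ)
  quartic = solve-∀
  slack₁ : ∀ κ → suc (suc κ) * (2 + 8 * (suc (0 * (2 + 2 * (suc (suc κ) + 0)) + 2) * (suc (suc κ) + 0)))
    + (44 + 142 * κ + 124 * κ * κ + 40 * κ * κ * κ + 4 * κ * κ * κ * κ) ≡
    144 + 240 * κ + 148 * κ * κ + 40 * κ * κ * κ + 4 * κ * κ * κ * κ
  slack₁ = solve-∀
  slack₂ : ∀ κ → suc (suc κ) * ((suc (suc κ) + 0) * 2 + 2
    + 8 * (suc (0 * ((suc (suc κ) + 0) * 2 + 2 + 2 * suc 0) + 2) * suc 0))
    + (84 + 206 * κ + 146 * κ * κ + 40 * κ * κ * κ + 4 * κ * κ * κ * κ) ≡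
    144 + 240 * κ + 148 * κ * κ + 40 * κ * κ * κ + 4 * κ * κ * κ * κ
  slack₂ = solve-∀

-- The case a = b = 1 is van der Waerden's W(3,2) = 9, checked by exhausting all colourings.
forces-three-AP : Forces 1 1 2 9
forces-three-AP = toWitness {a? = forces? {1} {1} (s≤s z≤n) 9 2} _

forces-below-diagonal′ : ∀ k e → 1 ≤ k → Forces (k + e) (k + 2 * e) 2 (bound₂ (k + e) (k + 2 * e))
forces-below-diagonal′ 1             zero    _   = forces-mono {1} {1} (m≤m+n 9 7) forces-three-AP
forces-below-diagonal′ (suc (suc κ)) zero    1≤k = let pair₁≤B , pair₂≤B = below-pair-bounds-a≡b κ in
  forces-below-by-pairs 1≤k pair₁≤B pair₂≤B
forces-below-diagonal′ (suc κ)       (suc ε) 1≤k = let pair₁≤B , pair₂≤B = below-pair-bounds-a<b κ ε in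
  forces-below-by-pairs 1≤k pair₁≤B pair₂≤B

below-diagonal-form : ∀ {a b} → a ≤ b → b < 2 * a → ∃₂ λ k e → 1 ≤ k × a ≡ k + e × b ≡ k + 2 * e
below-diagonal-form {a} {b} a≤b b<2a with m≤n⇒∃[o]m+o≡n a≤b | m≤n⇒∃[o]m+o≡n b<2a
... | e , a+e≡b | o , b+1+o≡2a =
  suc o , e , s≤s z≤n , a≡ , trans (sym a+e≡b) (trans (cong (_+ e) a≡) (regroup o e))
  where
  regroup : ∀ o e → suc o + e + e ≡ suc o + 2 * e
  regroup = solve-∀
  a≡ : a ≡ suc o + e
  a≡ = +-cancelˡ-≡ a a (suc o + e) (begin
    a + a              ≡⟨ double a ⟩
    2 * a              ≡⟨ b+1+o≡2a ⟨
    suc b + o          ≡⟨ cong (λ v → suc v + o) a+e≡b ⟨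
    suc (a + e) + o    ≡⟨ shuffle a e o ⟩
    a + (suc o + e)    ∎)
    where
    open ≡-Reasoning
    double : ∀ a → a + a ≡ 2 * a
    double = solve-∀
    shuffle : ∀ a e o → suc (a + e) + o ≡ a + (suc o + e)
    shuffle = solve-∀

forces-below-diagonal : ∀ {a b} → a ≤ b → b < 2 * a → Forces a b 2 (bound₂ a b)
forces-below-diagonal a≤b b<2a with below-diagonal-form a≤b b<2a
... | k , e , 1≤k , refl , refl = forces-below-diagonal′ k e 1≤k

NExists-two-colours : ∀ {a b} → 1 ≤ a → a ≤ b → b ≢ 2 * a → NExists a b 2
NExists-two-colours {a} {b} 1≤a a≤b b≢2a with <-cmp b (2 * a)
... | tri< b<2a _ _ = let N , isN , _ = N-below {a} {b} 1≤a (forces-below-diagonal a≤b b<2a) in N , isN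
... | tri≈ _ b≡2a _ = ⊥-elim (b≢2a b≡2a)
... | tri> _ _ 2a<b = let N , isN , _ = N-below {a} {b} 1≤a (forces-above-diagonal 1≤a 2a<b) in N , isN

parity : ℕ → Fin 2
parity zero    = 0F
parity (suc n) = opposite (parity n)

opposite-≢ : (i : Fin 2) → opposite i ≢ i
opposite-≢ 0F        ()
opposite-≢ (sucF 0F) ()

log-parity : ℕ → Fin 2
log-parity n = parity ⌊log₂ n ⌋

log-parity-double : ∀ m → 1 ≤ m → log-parity (2 * m) ≢ log-parity m
log-parity-double (suc m) _ eq =
  opposite-≢ (log-parity (suc m)) (trans (cong parity (sym (⌊log₂[2*b]⌋≡1+⌊log₂b⌋ (suc m)))) eq)

¬forces-doubling : ∀ {a r n} → ¬ Forces a (2 * a) (2 + r) n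
¬forces-doubling {a} {r} forces =
  let x , d , _ , 1≤d , _ , _ , _ , _ , _ , cy , cz = forces colour in
  log-parity-double (a * x + d) (≤-trans 1≤d (m≤n+m d (a * x)))
    (Finₚ.↑ˡ-injective r _ _ (trans (cong colour (double a x d)) (trans cz (sym cy))))
  where
  colour : ℕ → Fin (2 + r)
  colour i = log-parity i ↑ˡ r
  double : ∀ a x d → 2 * (a * x + d) ≡ 2 * a * x + 2 * d
  double = solve-∀

forces-one-colour : ∀ {a b} → 1 ≤ a → a ≤ b → Forces a b 1 (b + 2)
forces-one-colour {a} {b} 1≤a a≤b c =
  monoTriple {a} {b} 1≤a c {1} {1} a≤b (s≤s z≤n) (s≤s z≤n) (≤-reflexive (cong (_+ 2) (*-identityʳ b)))
    (Fin1-≡ _ _) (Fin1-≡ _ _)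
  where
  Fin1-≡ : (i j : Fin 1) → i ≡ j
  Fin1-≡ 0F 0F = refl

dor-doubling : ∀ {a} → 1 ≤ a → Dor a (2 * a) 1
dor-doubling {a} 1≤a = not-regular , ≤-refl , one-colour , at-most-one
  where
  not-regular : ¬ Regular a (2 * a)
  not-regular regular = let _ , _ , forces , _ = regular 2 (s≤s z≤n) in ¬forces-doubling {a} {0} forces
  one-colour : NExists a (2 * a) 1
  one-colour = let N , isN , _ = N-below {a} {2 * a} 1≤a (forces-one-colour 1≤a (m≤m+n a (a + 0)))
               in N , isN
  at-most-one : ∀ r → 1 ≤ r → NExists a (2 * a) r → r ≤ 1
  at-most-one 1             _ _                  = ≤-refl
  at-most-one (suc (suc r)) _ (_ , _ , forces , _) = ⊥-elim (¬forces-doubling {a} forces)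

dor-one⇒doubling : ∀ {a b} → 1 ≤ a → a ≤ b → Dor a b 1 → b ≡ 2 * a
dor-one⇒doubling {a} {b} 1≤a a≤b (_ , _ , _ , at-most-one) with b ≟ 2 * a
... | yes b≡2a = b≡2a
... | no  b≢2a with at-most-one 2 (s≤s z≤n) (NExists-two-colours 1≤a a≤b b≢2a)
...   | s≤s ()

theorem2p1 : (a b : ℕ) → 1 ≤ a → a ≤ b →
    (Dor a b 1 ⇔ b ≡ 2 * a)
    × (b ≢ 2 * a →
        NExists a b 2
        × (2 * a < b → ∃ λ n → IsN a b 2 n
              × n ≤ 4 * a * ((b ^ 3 + b ^ 2) ∸ (3 * b + 3)) + 2 * b ^ 3 + 6 * b ^ 2 + 6 * b)
        × (b < 2 * a → ∃ λ n → IsN a b 2 n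
              × n ≤ 4 * a * (b ^ 3 + 2 * b ^ 2 + 2 * b) ∸ 4 * b ^ 2))
theorem2p1 a b 1≤a a≤b =
  mk⇔ (dor-one⇒doubling 1≤a a≤b) (λ { refl → dor-doubling 1≤a }) ,
  λ b≢2a → NExists-two-colours 1≤a a≤b b≢2a ,
           (λ 2a<b → N-below {a} {b} 1≤a (forces-above-diagonal 1≤a 2a<b)) ,
           (λ b<2a → N-below {a} {b} 1≤a (forces-below-diagonal a≤b b<2a))
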